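{- Let $A=(a_{u,v})$ be an $n\times n$ Robinson matrix with entries in $\{0,\dots,k\}$ and all diagonal entries equal to $k$, and let $\mathbf d\in\mathbb D^k$ be such that for all $u<v$ in $[n]$, every $\mathbf b\in UB(u,v)$ and every $\mathbf a\in LB(u,v)$ satisfy $\mathbf a^\top\mathbf d<\mathbf b^\top\mathbf d$. Define $\Pi:[n]\to\mathbb R$ by $\Pi(1)=0$ and, for $2\le v\le n$, $\Pi(v)=(ub_v+lb_v)/2$, where $$ub_v=\min_{i\in[v-1]}\Big\{\Pi(i)+\min\{\mathbf b^\top\mathbf d:\mathbf b\in UB(i,v)\}\Big\},\qquad lb_v=\max_{i\in[v-1]}\Big\{\Pi(i)+\max\{\mathbf a^\top\mathbf d:\mathbf a\in LB(i,v)\}\Big\}.$$ Then for all $u,v\in[n]$ with $u<v$ and all $t\in\{0,\dots,k\}$: $a_{u,v}=t\iff d_{t+1}<\Pi(v)-\Pi(u)<d_t$, where $d_{k+1}=0$ and $d_0=\infty$.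
   Context: $[n]=\{1,\dots,n\}$; Robinson matrix: symmetric with $a_{u,v}\ge a_{u,w}$ and $a_{v,w}\ge a_{u,w}$ for all $u<v<w$. $\mathbb D^k=\{\mathbf d\in\mathbb R^k:d_1>\dots>d_k>0\}$. With $\chi_i$ the $i$-th unit vector of $\mathbb Z^k$: for $u<v$, $\beta^+(u,v)=\chi_t$ if $a_{u,v}=t\ge1$ (undefined if $a_{u,v}=0$), $\beta^-(u,v)=\chi_{t+1}$ if $a_{u,v}=t\le k-1$ and $\mathbf 0$ if $a_{u,v}=k$; $\beta^+(v,u)=-\beta^-(u,v)$, $\beta^-(v,u)=-\beta^+(u,v)$. $\{u,v\}$ is an edge if $a_{u,v}>0$. A $(u,v)$-walk $\langle w_0,\dots,w_p\rangle$ ($w_0=u$, $w_p=v$) is an upper-bound-walk if $\{w_{i-1},w_i\}$ is an edge whenever $w_{i-1}<w_i$, a lower-bound-walk if $\{w_{i-1},w_i\}$ is an edge whenever $w_{i-1}>w_i$; $\beta^+(W)=\sum_i\beta^+(w_{i-1},w_i)$, $\beta^-(W)=\sum_i\beta^-(w_{i-1},w_i)$ respectively. A path is a walk without repeated vertices. $UB(u,v)=\{\beta^+(W): W$ a $(u,v)$-upper-bound-path$\}$ and $LB(u,v)=\{\beta^-(W): W$ a $(u,v)$-lower-bound-path$\}$. -}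

module Defs where

open import Level using (0ℓ)
open import Data.Nat as ℕ using (ℕ; zero; suc; _≡ᵇ_)
open import Data.Nat.Properties using ()
open import Data.Bool using (if_then_else_)
open import Data.Integer as ℤ using (ℤ; +_; -[1+_])
open import Data.Fin as Fin using (Fin; toℕ; fromℕ<)
open import Data.Vec using (Vec; []; _∷_; lookup; tabulate; replicate; zipWith; map)
open import Data.List using (List; []; _∷_)
open import Data.List.Relation.Unary.Unique.Propositional using (Unique)
open import Data.Product using (Σ; ∃; _×_; _,_)
open import Data.Unit using (⊤)
open import Relation.Nullary using (¬_; yes; no)
open import Relation.Binary.PropositionalEquality using (_≡_; _≢_)
open import Algebra.Structures using (IsCommutativeRing)
open import Relation.Binary.Structures using (IsStrictTotalOrder)

-- An ordered field (ℝ is an instance).  The statement is proved for an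
-- arbitrary ordered field, which in particular covers the reals.

record OrderedField : Set₁ where
  infixl 7 _*_
  infixl 6 _+_
  infix  4 _<_
  field
    Carrier : Set
    _+_ _*_ : Carrier → Carrier → Carrier
    -_      : Carrier → Carrier
    0# 1#   : Carrier
    _<_     : Carrier → Carrier → Set
    isCommutativeRing : IsCommutativeRing _≡_ _+_ _*_ -_ 0# 1#
    0≢1     : 0# ≢ 1#
    inverse : ∀ x → x ≢ 0# → Σ Carrier λ y → x * y ≡ 1#
    <-isStrictTotalOrder : IsStrictTotalOrder _≡_ _<_
    +-mono-< : ∀ {a b} c → a < b → a + c < b + c
    *-pos    : ∀ {a b} → 0# < a → 0# < b → 0# < a * b

  _≤_ : Carrier → Carrier → Set
  x ≤ y = ¬ (y < x)

  _-_ : Carrier → Carrier → Carrier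
  x - y = x + (- y)

  fromℕ : ℕ → Carrier
  fromℕ zero    = 0#
  fromℕ (suc m) = 1# + fromℕ m

  fromℤ : ℤ → Carrier
  fromℤ (+ m)      = fromℕ m
  fromℤ -[1+ m ]   = - fromℕ (suc m)

-- Matrices, Robinson property.  Vertex u ∈ [n] is represented by
-- (u : Fin n) with toℕ u = u - 1; the order on [n] is Fin's _<_.

Matrix : ℕ → Set
Matrix n = Fin n → Fin n → ℕ

IsRobinson : ∀ {n} → Matrix n → Set
IsRobinson {n} A =
  (∀ u v → A u v ≡ A v u) ×
  (∀ (u v w : Fin n) → u Fin.< v → v Fin.< w →
      (A u w ℕ.≤ A u v) × (A u w ℕ.≤ A v w))

EntriesIn0to : ℕ → ∀ {n} → Matrix n → Set
EntriesIn0to k A = ∀ u v → A u v ℕ.≤ k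

DiagonalIs : ℕ → ∀ {n} → Matrix n → Set
DiagonalIs k A = ∀ u → A u u ≡ k

Zvec : ℕ → Set
Zvec k = Vec ℤ k

zeroV : ∀ {k} → Zvec k
zeroV = replicate _ (+ 0)

_⊕_ : ∀ {k} → Zvec k → Zvec k → Zvec k
_⊕_ = zipWith ℤ._+_

negV : ∀ {k} → Zvec k → Zvec k
negV = map (λ z → ℤ.- z)

-- χ t = the t-th unit vector of ℤ^k (1 ≤ t ≤ k); index t lives at Fin position t-1.
χ : ∀ {k} → ℕ → Zvec k
χ t = tabulate λ i → if suc (toℕ i) ≡ᵇ t then + 1 else + 0

module Beta {n k : ℕ} (A : Matrix n) where

  -- for u < v:  β⁺(u,v) = χ_{a_{u,v}}  (only used when a_{u,v} ≥ 1)
  βp< : Fin n → Fin n → Zvec k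
  βp< u v = χ (A u v)

  βm< : Fin n → Fin n → Zvec k
  βm< u v with A u v ℕ.≟ k
  ... | yes _ = zeroV
  ... | no  _ = χ (suc (A u v))

  β⁺ : Fin n → Fin n → Zvec k
  β⁺ x y with x Fin.<? y
  ... | yes _ = βp< x y
  ... | no  _ = negV (βm< y x)

  β⁻ : Fin n → Fin n → Zvec k
  β⁻ x y with x Fin.<? y
  ... | yes _ = βm< x y
  ... | no  _ = negV (βp< y x)

  -- A walk ⟨w₀,…,w_p⟩ is represented by w₀ and the list [w₁,…,w_p].
  lastV : Fin n → List (Fin n) → Fin n
  lastV x []       = x
  lastV x (y ∷ ys) = lastV y ys

  IsPath : Fin n → Fin n → List (Fin n) → Set
  IsPath u v ws = Unique (u ∷ ws) × lastV u ws ≡ v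

  -- upper-bound condition: upward steps are edges
  UBSteps : Fin n → List (Fin n) → Set
  UBSteps x []       = ⊤
  UBSteps x (y ∷ ys) = (x Fin.< y → 1 ℕ.≤ A x y) × UBSteps y ys

  LBSteps : Fin n → List (Fin n) → Set
  LBSteps x []       = ⊤
  LBSteps x (y ∷ ys) = (y Fin.< x → 1 ℕ.≤ A y x) × LBSteps y ys

  β⁺W : Fin n → List (Fin n) → Zvec k
  β⁺W x []       = zeroV
  β⁺W x (y ∷ ys) = β⁺ x y ⊕ β⁺W y ys

  β⁻W : Fin n → List (Fin n) → Zvec k
  β⁻W x []       = zeroV
  β⁻W x (y ∷ ys) = β⁻ x y ⊕ β⁻W y ys

  UB : Fin n → Fin n → Zvec k → Set
  UB u v b = Σ (List (Fin n)) λ ws → IsPath u v ws × UBSteps u ws × β⁺W u ws ≡ b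

  LB : Fin n → Fin n → Zvec k → Set
  LB u v a = Σ (List (Fin n)) λ ws → IsPath u v ws × LBSteps u ws × β⁻W u ws ≡ a

module WithField (F : OrderedField) where
  open OrderedField F

  dot : ∀ {k} → Vec Carrier k → Zvec k → Carrier
  dot []       []       = 0#
  dot (d ∷ ds) (b ∷ bs) = fromℤ b * d + dot ds bs

  InD : ∀ {k} → Vec Carrier k → Set
  InD {k} d = (∀ (i j : Fin k) → i Fin.< j → lookup d j < lookup d i)
            × (∀ (i : Fin k) → 0# < lookup d i)

  -- d_m for 1 ≤ m ≤ k, and d_{k+1} = 0 (d_0 = ∞ handled in Between)
  dAt : ∀ {k} → Vec Carrier k → ℕ → Carrier
  dAt d zero = 0#                      -- unused
  dAt {k} d (suc m) with m ℕ.<? k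
  ... | yes p = lookup d (fromℕ< p)
  ... | no  _ = 0#

  Between : ∀ {k} → Vec Carrier k → ℕ → Carrier → Set
  Between d t x = (dAt d (suc t) < x) × Upper t
    where
      Upper : ℕ → Set
      Upper zero    = ⊤
      Upper (suc s) = x < dAt d (suc s)

  IsMin : Carrier → (Carrier → Set) → Set
  IsMin x P = P x × (∀ y → P y → x ≤ y)

  IsMax : Carrier → (Carrier → Set) → Set
  IsMax x P = P x × (∀ y → P y → y ≤ x)

  module _ {n k : ℕ} (A : Matrix n) (d : Vec Carrier k) where
    open Beta {n} {k} A

    UBvals : (Fin n → Carrier) → Fin n → Carrier → Set
    UBvals Π v x = Σ (Fin n) λ i → i Fin.< v × Σ (Zvec k) λ b → UB i v b × x ≡ Π i + dot d b

    LBvals : (Fin n → Carrier) → Fin n → Carrier → Set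
    LBvals Π v x = Σ (Fin n) λ i → i Fin.< v × Σ (Zvec k) λ a → LB i v a × x ≡ Π i + dot d a

    -- Π satisfies the recursive definition: Π(1) = 0 and for v ≥ 2,
    -- Π(v) = (ub_v + lb_v)/2 (written 2·Π(v) = ub_v + lb_v).
    IsPi : (Fin n → Carrier) → Set
    IsPi Π = (∀ v → toℕ v ≡ 0 → Π v ≡ 0#)
           × (∀ v → 0 ℕ.< toℕ v →
                Σ Carrier λ ub → Σ Carrier λ lb →
                  IsMin ub (UBvals Π v) × IsMax lb (LBvals Π v) × Π v + Π v ≡ ub + lb)

    Separates : Set
    Separates = ∀ (u v : Fin n) → u Fin.< v → ∀ b a → UB u v b → LB u v a → dot d a < dot d b

{-# OPTIONS --safe #-}
-- Write c⁺ x y = β⁺(x,y)ᵀd and c⁻ x y = β⁻(x,y)ᵀd, so that the elements of UB(u,v) and LB(u,v),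
-- paired with d, are weights of upper- and lower-bound paths. Since c⁺ y x = -c⁻ x y, reversing
-- an upper-bound path gives a lower-bound path of opposite weight. Hence separation makes every
-- lower-bound cycle non-positive, and so every lower-bound walk can be shortened to a
-- lower-bound path of no smaller weight.
--
-- By strong induction on v, Π v - Π u lies strictly between every bᵀd, b ∈ UB(u,v), and every
-- aᵀd, a ∈ LB(u,v), for all u < v. For the step it suffices that lb_v < ub_v, since Π v is their
-- midpoint. A lower path i → v followed by a reversed upper path j → v is a lower walk i → j;
-- shortened to a path, the induction hypothesis at max(i,j) bounds its weight by Π j - Π i
-- (i = j is separation itself). Finally the one-edge path ⟨u,v⟩ gives
-- d_{a+1} < Π v - Π u < d_a for a = a_{u,v}, and these intervals are disjoint as d is decreasing.
module Submission where

open import Defs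
open import Level using (0ℓ)
open import Data.Nat as ℕ using (ℕ; zero; suc; s≤s)
import Data.Nat.Properties as ℕ
open import Data.Integer as ℤ using (-[1+_]; _⊖_)
import Data.Integer.Properties as ℤ
open import Data.Fin as Fin using (Fin; fromℕ<)
import Data.Fin.Properties as Fin
open import Data.Fin.Induction using (<-wellFounded)
open import Induction.WellFounded using (Acc; acc)
open import Data.Vec using (Vec; []; _∷_; lookup)
open import Data.List using (List; []; _∷_; _++_; reverse)
import Data.List.Properties as List
open import Data.List.Relation.Unary.All as All using ([]; _∷_)
open import Data.List.Relation.Unary.All.Properties using (++⁻ˡ; ++⁻ʳ; ¬Any⇒All¬)
open import Data.List.Membership.Propositional using (_∈_)
open import Data.List.Membership.Propositional.Properties using (∈-∃++)
import Data.List.Membership.DecPropositional as DecMembership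
open import Data.List.Relation.Unary.AllPairs using ([]; _∷_)
open import Data.List.Relation.Unary.Unique.Propositional using (Unique)
open import Data.Product using (Σ; _×_; _,_; proj₁; proj₂)
open import Data.Unit using (⊤; tt)
open import Data.Empty using (⊥; ⊥-elim)
open import Data.Sum using (inj₁; inj₂)
open import Relation.Nullary using (¬_; yes; no; Dec)
open import Relation.Binary.Definitions using (Tri; tri<; tri≈; tri>)
open import Relation.Binary.PropositionalEquality
open import Relation.Binary.PropositionalEquality.Properties using (setoid)
open import Relation.Binary.Structures using (IsStrictTotalOrder)
open import Function.Base using (_∘_; flip; id)
open import Function.Bundles using (_⇔_; mk⇔)
open import Algebra.Bundles using (CommutativeRing)
import Algebra.Properties.Ring as RingProperties
import Algebra.Properties.CommutativeSemigroup as CommutativeSemigroupProperties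

module OrderedFieldProperties (F : OrderedField) where
  open OrderedField F
  open IsStrictTotalOrder <-isStrictTotalOrder public
    using (compare; irrefl; asym) renaming (trans to <-trans)

  commutativeRing : CommutativeRing 0ℓ 0ℓ
  commutativeRing = record { isCommutativeRing = isCommutativeRing }

  open CommutativeRing commutativeRing public
    using (+-comm; +-assoc; +-identityˡ; +-identityʳ; -‿inverseˡ; -‿inverseʳ; *-identityˡ; distribʳ; zeroˡ)
  open RingProperties (CommutativeRing.ring commutativeRing) public
    using (-‿involutive; -0#≈0#; -‿+-comm; -‿distribˡ-*; xyx⁻¹≈y; ⁻¹-anti-homo‿-;
           //-rightDividesʳ; \\-leftDividesˡ; \\-leftDividesʳ)
  open CommutativeSemigroupProperties (CommutativeRing.+-commutativeSemigroup commutativeRing) public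
    using (interchange)
  open ≡-Reasoning

  ≤-refl : ∀ {a} → a ≤ a
  ≤-refl = irrefl refl

  <⇒≤ : ∀ {a b} → a < b → a ≤ b
  <⇒≤ = asym

  <-≤-trans : ∀ {a b c} → a < b → b ≤ c → a < c
  <-≤-trans {a} {b} {c} a<b b≤c with compare a c
  ... | tri< a<c _ _ = a<c
  ... | tri≈ _ refl _ = ⊥-elim (b≤c a<b)
  ... | tri> _ _ c<a = ⊥-elim (b≤c (<-trans c<a a<b))

  ≤-<-trans : ∀ {a b c} → a ≤ b → b < c → a < c
  ≤-<-trans {a} {b} {c} a≤b b<c with compare a c
  ... | tri< a<c _ _ = a<c
  ... | tri≈ _ refl _ = ⊥-elim (a≤b b<c)
  ... | tri> _ _ c<a = ⊥-elim (a≤b (<-trans b<c c<a))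

  ≤-trans : ∀ {a b c} → a ≤ b → b ≤ c → a ≤ c
  ≤-trans a≤b b≤c c<a = b≤c (<-≤-trans c<a a≤b)

  +-monoʳ-< : ∀ {a b} c → a < b → c + a < c + b
  +-monoʳ-< {a} {b} c a<b = subst₂ _<_ (+-comm a c) (+-comm b c) (+-mono-< c a<b)

  +-cancelʳ-< : ∀ {a b} c → a + c < b + c → a < b
  +-cancelʳ-< {a} {b} c = subst₂ _<_ (//-rightDividesʳ c a) (//-rightDividesʳ c b) ∘ +-mono-< (- c)

  +-monoʳ-≤ : ∀ {a b} c → a ≤ b → (c + a) ≤ (c + b)
  +-monoʳ-≤ {a} {b} c a≤b = a≤b ∘ +-cancelʳ-< c ∘ subst₂ _<_ (+-comm c b) (+-comm c a)

  +-monoˡ-≤ : ∀ {a b} c → a ≤ b → (a + c) ≤ (b + c)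
  +-monoˡ-≤ {a} {b} c = subst₂ _≤_ (+-comm c a) (+-comm c b) ∘ +-monoʳ-≤ c

  neg-antitone-< : ∀ {a b} → a < b → - b < - a
  neg-antitone-< {a} {b} a<b = subst₂ _<_ eqˡ eqʳ (+-mono-< (- a + - b) a<b)
    where
    eqˡ : a + (- a + - b) ≡ - b
    eqˡ = \\-leftDividesˡ a (- b)
    eqʳ : b + (- a + - b) ≡ - a
    eqʳ = trans (cong (b +_) (+-comm (- a) (- b))) (\\-leftDividesˡ b (- a))

  neg-nonpos : ∀ {a} → 0# ≤ a → (- a) ≤ 0#
  neg-nonpos 0≤a 0<-a = 0≤a (subst₂ _<_ (-‿involutive _) -0#≈0# (neg-antitone-< 0<-a))

  private
    half-< : ∀ {a b} → a + a < b + b → a < b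
    half-< {a} {b} 2a<2b with compare a b
    ... | tri< a<b _ _ = a<b
    ... | tri≈ _ refl _ = ⊥-elim (irrefl refl 2a<2b)
    ... | tri> _ _ b<a = ⊥-elim (asym 2a<2b (<-trans (+-mono-< b b<a) (+-monoʳ-< a b<a)))

  midpoint : ∀ {lb ub p} → lb < ub → p + p ≡ ub + lb → lb < p × p < ub
  midpoint {lb} {ub} lb<ub 2p≡ub+lb =
    half-< (subst (lb + lb <_) (sym 2p≡ub+lb) (+-mono-< lb lb<ub)) ,
    half-< (subst (_< ub + ub) (sym 2p≡ub+lb) (+-monoʳ-< ub lb<ub))

  x<y+z⇒x-y<z : ∀ {x y z} → x < y + z → x - y < z
  x<y+z⇒x-y<z {y = y} {z} x<y+z = subst (_ <_) (xyx⁻¹≈y y z) (+-mono-< (- y) x<y+z)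

  y+z<x⇒z<x-y : ∀ {x y z} → y + z < x → z < x - y
  y+z<x⇒z<x-y {y = y} {z} y+z<x = subst (_< _) (xyx⁻¹≈y y z) (+-mono-< (- y) y+z<x)

  x<-y⇒x+y<0 : ∀ {x y} → x < - y → x + y < 0#
  x<-y⇒x+y<0 {y = y} x<-y = subst (_ <_) (-‿inverseˡ y) (+-mono-< y x<-y)

  x-y<-z⇒z<y-x : ∀ {x y z} → x - y < - z → z < y - x
  x-y<-z⇒z<y-x {x} {y} {z} = subst₂ _<_ (-‿involutive z) (⁻¹-anti-homo‿- x y) ∘ neg-antitone-<

  x-y<z-w⇒w+x<z+y : ∀ {x y z w} → x - y < z - w → w + x < z + y
  x-y<z-w⇒w+x<z+y {x} {y} {z} {w} = subst₂ _<_ eqˡ (sub-add z w y) ∘ +-mono-< (w + y)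
    where
    sub-add : ∀ a b c → (a - b) + (b + c) ≡ a + c
    sub-add a b c = trans (+-assoc a (- b) (b + c)) (cong (a +_) (\\-leftDividesʳ b c))
    eqˡ : (x - y) + (w + y) ≡ w + x
    eqˡ = begin
      (x - y) + (w + y) ≡⟨ cong ((x - y) +_) (+-comm w y) ⟩
      (x - y) + (y + w) ≡⟨ sub-add x y w ⟩
      x + w             ≡⟨ +-comm x w ⟩
      w + x             ∎

module DotProperties (F : OrderedField) where
  open OrderedField F
  open OrderedFieldProperties F
  open WithField F
  open ≡-Reasoning

  fromℕ-+ : ∀ m n → fromℕ (m ℕ.+ n) ≡ fromℕ m + fromℕ n
  fromℕ-+ zero    n = sym (+-identityˡ _)
  fromℕ-+ (suc m) n = trans (cong (1# +_) (fromℕ-+ m n)) (sym (+-assoc 1# _ _))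

  fromℤ-⊖ : ∀ m n → fromℤ (m ⊖ n) ≡ fromℕ m - fromℕ n
  fromℤ-⊖ m       zero    = sym (trans (cong (fromℕ m +_) -0#≈0#) (+-identityʳ _))
  fromℤ-⊖ zero    (suc n) = sym (+-identityˡ _)
  fromℤ-⊖ (suc m) (suc n) = begin
    fromℤ (suc m ⊖ suc n)               ≡⟨ cong fromℤ (ℤ.[1+m]⊖[1+n]≡m⊖n m n) ⟩
    fromℤ (m ⊖ n)                       ≡⟨ fromℤ-⊖ m n ⟩
    a - b                               ≡⟨ sym (+-identityˡ _) ⟩
    0# + (a - b)                        ≡⟨ cong (_+ (a - b)) (sym (-‿inverseʳ 1#)) ⟩
    (1# - 1#) + (a - b)                 ≡⟨ interchange 1# (- 1#) a (- b) ⟩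
    (1# + a) + (- 1# + - b)             ≡⟨ cong ((1# + a) +_) (-‿+-comm 1# b) ⟩
    (1# + a) - (1# + b)                 ∎
    where
    a = fromℕ m
    b = fromℕ n

  fromℤ-+ : ∀ x y → fromℤ (x ℤ.+ y) ≡ fromℤ x + fromℤ y
  fromℤ-+ (ℤ.+ m)  (ℤ.+ n)  = fromℕ-+ m n
  fromℤ-+ (ℤ.+ m)  -[1+ n ] = fromℤ-⊖ m (suc n)
  fromℤ-+ -[1+ m ] (ℤ.+ n)  = trans (fromℤ-⊖ n (suc m)) (+-comm _ _)
  fromℤ-+ -[1+ m ] -[1+ n ] = begin
    - (1# + (1# + fromℕ (m ℕ.+ n)))     ≡⟨ cong (λ z → - (1# + (1# + z))) (fromℕ-+ m n) ⟩
    - (1# + (1# + (a + b)))             ≡⟨ cong -_ (sym (+-assoc 1# 1# (a + b))) ⟩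
    - ((1# + 1#) + (a + b))             ≡⟨ cong -_ (interchange 1# 1# a b) ⟩
    - ((1# + a) + (1# + b))             ≡⟨ sym (-‿+-comm (1# + a) (1# + b)) ⟩
    - (1# + a) + - (1# + b)             ∎
    where
    a = fromℕ m
    b = fromℕ n

  fromℤ-neg : ∀ x → fromℤ (ℤ.- x) ≡ - fromℤ x
  fromℤ-neg (ℤ.+ zero)  = sym -0#≈0#
  fromℤ-neg (ℤ.+ suc n) = refl
  fromℤ-neg -[1+ n ]    = sym (-‿involutive _)

  dot-zeroV : ∀ {k} (d : Vec Carrier k) → dot d zeroV ≡ 0#
  dot-zeroV []       = refl
  dot-zeroV (e ∷ ds) = trans (cong₂ _+_ (zeroˡ e) (dot-zeroV ds)) (+-identityˡ 0#)

  dot-⊕ : ∀ {k} (d : Vec Carrier k) a b → dot d (a ⊕ b) ≡ dot d a + dot d b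
  dot-⊕ []       []      []      = sym (+-identityˡ 0#)
  dot-⊕ (e ∷ ds) (x ∷ a) (y ∷ b) = begin
    fromℤ (x ℤ.+ y) * e + dot ds (a ⊕ b)
      ≡⟨ cong₂ _+_ (trans (cong (_* e) (fromℤ-+ x y)) (distribʳ e _ _)) (dot-⊕ ds a b) ⟩
    (fromℤ x * e + fromℤ y * e) + (dot ds a + dot ds b)
      ≡⟨ interchange _ _ _ _ ⟩
    (fromℤ x * e + dot ds a) + (fromℤ y * e + dot ds b)
      ∎

  dot-negV : ∀ {k} (d : Vec Carrier k) a → dot d (negV a) ≡ - dot d a
  dot-negV []       []      = sym -0#≈0#
  dot-negV (e ∷ ds) (x ∷ a) = begin
    fromℤ (ℤ.- x) * e + dot ds (negV a)
      ≡⟨ cong₂ _+_ (trans (cong (_* e) (fromℤ-neg x)) (sym (-‿distribˡ-* _ e))) (dot-negV ds a) ⟩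
    - (fromℤ x * e) + - dot ds a
      ≡⟨ -‿+-comm _ _ ⟩
    - (fromℤ x * e + dot ds a)
      ∎

  dAt-< : ∀ {k} (d : Vec Carrier k) m (m<k : m ℕ.< k) → dAt d (suc m) ≡ lookup d (fromℕ< m<k)
  dAt-< {k} d m m<k with m ℕ.<? k
  ... | yes _    = refl
  ... | no  m≮k  = ⊥-elim (m≮k m<k)

  dAt-≮ : ∀ {k} (d : Vec Carrier k) m → ¬ (m ℕ.< k) → dAt d (suc m) ≡ 0#
  dAt-≮ {k} d m m≮k with m ℕ.<? k
  ... | yes m<k = ⊥-elim (m≮k m<k)
  ... | no  _   = refl

  dAt-∷ : ∀ {k} e (d : Vec Carrier k) m → dAt (e ∷ d) (suc (suc m)) ≡ dAt d (suc m)
  dAt-∷ {k} e d m with m ℕ.<? k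
  ... | yes m<k = dAt-< (e ∷ d) (suc m) (s≤s m<k)
  ... | no  m≮k = dAt-≮ (e ∷ d) (suc m) (m≮k ∘ ℕ.≤-pred)

  -- At t = 0 both sides are 0: χ 0 is the zero vector and dAt d 0 is the junk value 0.
  dot-χ : ∀ {k} (d : Vec Carrier k) t → dot d (χ t) ≡ dAt d t
  dot-χ []       zero          = refl
  dot-χ []       (suc t)       = sym (dAt-≮ [] t λ ())
  dot-χ (e ∷ ds) zero          = trans (cong₂ _+_ (zeroˡ e) (dot-χ ds zero)) (+-identityˡ 0#)
  dot-χ (e ∷ ds) (suc zero)    = begin
    (1# + 0#) * e + dot ds (χ zero)   ≡⟨ cong₂ _+_ (trans (cong (_* e) (+-identityʳ 1#)) (*-identityˡ e)) (dot-χ ds zero) ⟩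
    e + 0#                            ≡⟨ +-identityʳ e ⟩
    e                                 ∎
  dot-χ (e ∷ ds) (suc (suc t)) = begin
    0# * e + dot ds (χ (suc t))       ≡⟨ cong₂ _+_ (zeroˡ e) (dot-χ ds (suc t)) ⟩
    0# + dAt ds (suc t)               ≡⟨ +-identityˡ _ ⟩
    dAt ds (suc t)                    ≡⟨ sym (dAt-∷ e ds t) ⟩
    dAt (e ∷ ds) (suc (suc t))        ∎

  module _ {k} {d : Vec Carrier k} (d∈𝔻 : InD d) where

    dAt-nonneg : ∀ t → 0# ≤ dAt d t
    dAt-nonneg zero    = ≤-refl
    dAt-nonneg (suc m) with m ℕ.<? k
    ... | yes m<k = <⇒≤ (proj₂ d∈𝔻 (fromℕ< m<k))
    ... | no  _   = ≤-refl

    dAt-antitone : ∀ {s t} → s ℕ.≤ t → dAt d (suc t) ≤ dAt d (suc s)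
    dAt-antitone {s} {t} s≤t with ℕ.m≤n⇒m<n∨m≡n s≤t
    ... | inj₂ refl = ≤-refl
    ... | inj₁ s<t  = strict (t ℕ.<? k)
      where
      strict : Dec (t ℕ.< k) → dAt d (suc t) ≤ dAt d (suc s)
      strict (no t≮k) = subst (_≤ dAt d (suc s)) (sym (dAt-≮ d t t≮k)) (dAt-nonneg (suc s))
      strict (yes t<k) = subst₂ _≤_ (sym (dAt-< d t t<k)) (sym (dAt-< d s s<k))
                           (<⇒≤ (proj₁ d∈𝔻 _ _ index<))
        where
        s<k = ℕ.<-trans s<t t<k
        index< : fromℕ< s<k Fin.< fromℕ< t<k
        index< = subst₂ ℕ._<_ (sym (Fin.toℕ-fromℕ< s<k)) (sym (Fin.toℕ-fromℕ< t<k)) s<t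

    Between-disjoint : ∀ {s t x} → s ℕ.< t → Between d s x → Between d t x → ⊥
    Between-disjoint {t = suc t} (s≤s s≤t) (dₛ₊₁<x , _) (_ , x<dₜ₊₁) =
      irrefl refl (<-trans (<-≤-trans x<dₜ₊₁ (dAt-antitone s≤t)) dₛ₊₁<x)

    Between-unique : ∀ {s t x} → Between d s x → Between d t x → s ≡ t
    Between-unique {s} {t} bs bt with ℕ.<-cmp s t
    ... | tri< s<t _ _ = ⊥-elim (Between-disjoint s<t bs bt)
    ... | tri≈ _ s≡t _ = s≡t
    ... | tri> _ _ t<s = ⊥-elim (Between-disjoint t<s bt bs)

module _ {X : Set} where
  open import Data.List.Relation.Binary.Permutation.Setoid (setoid X) using (↭-sym)
  open import Data.List.Relation.Binary.Permutation.Setoid.Properties (setoid X)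
    using (Unique-resp-↭; ↭-reverse)

  Unique-reverse : ∀ {xs : List X} → Unique xs → Unique (reverse xs)
  Unique-reverse {xs} = Unique-resp-↭ (↭-sym (↭-reverse xs))

  Unique-++⁻ˡ : ∀ (xs : List X) {ys} → Unique (xs ++ ys) → Unique xs
  Unique-++⁻ˡ []       _              = []
  Unique-++⁻ˡ (x ∷ xs) (x∉xs++ys ∷ u) = ++⁻ˡ xs x∉xs++ys ∷ Unique-++⁻ˡ xs u

  Unique-++⁻ʳ : ∀ (xs : List X) {ys} → Unique (xs ++ ys) → Unique ys
  Unique-++⁻ʳ []       u       = u
  Unique-++⁻ʳ (x ∷ xs) (_ ∷ u) = Unique-++⁻ʳ xs u

module Walks (F : OrderedField) {n k : ℕ} (A : Matrix n) where
  open OrderedField F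
  open OrderedFieldProperties F
  open Beta {n} {k} A
  open ≡-Reasoning

  Steps : (Fin n → Fin n → Set) → Fin n → List (Fin n) → Set
  Steps R x []       = ⊤
  Steps R x (y ∷ ys) = R x y × Steps R y ys

  weight : (Fin n → Fin n → Carrier) → Fin n → List (Fin n) → Carrier
  weight c x []       = 0#
  weight c x (y ∷ ys) = c x y + weight c y ys

  reverseWalk : Fin n → List (Fin n) → List (Fin n)
  reverseWalk x []       = []
  reverseWalk x (y ∷ ys) = reverseWalk y ys ++ x ∷ []

  lastV-++ : ∀ x ws ys → lastV x (ws ++ ys) ≡ lastV (lastV x ws) ys
  lastV-++ x []       ys = refl
  lastV-++ x (w ∷ ws) ys = lastV-++ w ws ys

  lastV-reverseWalk : ∀ x ws → lastV (lastV x ws) (reverseWalk x ws) ≡ x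
  lastV-reverseWalk x []       = refl
  lastV-reverseWalk x (y ∷ ys) = lastV-++ (lastV y ys) (reverseWalk y ys) (x ∷ [])

  reverseWalk-reverse : ∀ x ws → lastV x ws ∷ reverseWalk x ws ≡ reverse (x ∷ ws)
  reverseWalk-reverse x []       = refl
  reverseWalk-reverse x (y ∷ ys) = begin
    lastV y ys ∷ reverseWalk y ys ++ x ∷ []  ≡⟨ cong (_++ x ∷ []) (reverseWalk-reverse y ys) ⟩
    reverse (y ∷ ys) ++ x ∷ []               ≡⟨ sym (List.unfold-reverse x (y ∷ ys)) ⟩
    reverse (x ∷ y ∷ ys)                     ∎

  IsPath-reverseWalk : ∀ {u v} ws → IsPath u v ws → IsPath v u (reverseWalk u ws)
  IsPath-reverseWalk {u} ws (unique , refl) =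
    subst Unique (sym (reverseWalk-reverse u ws)) (Unique-reverse unique) ,
    lastV-reverseWalk u ws

  edgePath : ∀ {x y} → x ≢ y → IsPath x y (y ∷ [])
  edgePath x≢y = ((x≢y ∷ []) ∷ [] ∷ []) , refl

  module _ {R : Fin n → Fin n → Set} where

    Steps-++ : ∀ x ws {ys} → Steps R x ws → Steps R (lastV x ws) ys → Steps R x (ws ++ ys)
    Steps-++ x []       _       s = s
    Steps-++ x (w ∷ ws) (r , s) t = r , Steps-++ w ws s t

    Steps-split : ∀ x qs {m rs} → Steps R x (qs ++ m ∷ rs) → Steps R x (qs ++ m ∷ []) × Steps R m rs
    Steps-split x []       (r , s) = (r , tt) , s
    Steps-split x (q ∷ qs) (r , s) = let (s₁ , s₂) = Steps-split q qs s in (r , s₁) , s₂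

  Steps-reverseWalk : ∀ {R} x ws → Steps R x ws → Steps (flip R) (lastV x ws) (reverseWalk x ws)
  Steps-reverseWalk x []       _       = tt
  Steps-reverseWalk {R} x (y ∷ ys) (r , s) =
    Steps-++ (lastV y ys) (reverseWalk y ys) (Steps-reverseWalk y ys s)
      (subst (R x) (sym (lastV-reverseWalk y ys)) r , tt)

  module _ (c : Fin n → Fin n → Carrier) where

    weight-++ : ∀ x ws ys → weight c x (ws ++ ys) ≡ weight c x ws + weight c (lastV x ws) ys
    weight-++ x []       ys = sym (+-identityˡ _)
    weight-++ x (w ∷ ws) ys = begin
      c x w + weight c w (ws ++ ys)                          ≡⟨ cong (c x w +_) (weight-++ w ws ys) ⟩
      c x w + (weight c w ws + weight c (lastV w ws) ys)     ≡⟨ sym (+-assoc _ _ _) ⟩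
      (c x w + weight c w ws) + weight c (lastV w ws) ys     ∎

    weight-split : ∀ x qs {m rs} → weight c x (qs ++ m ∷ rs) ≡ weight c x (qs ++ m ∷ []) + weight c m rs
    weight-split x []       {m} {rs} = cong (_+ weight c m rs) (sym (+-identityʳ (c x m)))
    weight-split x (q ∷ qs)     = trans (cong (c x q +_) (weight-split q qs)) (sym (+-assoc _ _ _))

  weight-reverseWalk : ∀ c c′ → (∀ x y → x ≢ y → c′ y x ≡ - c x y) →
                       ∀ x ws → Unique (x ∷ ws) → weight c′ (lastV x ws) (reverseWalk x ws) ≡ - weight c x ws
  weight-reverseWalk c c′ antisym x []       _          = sym -0#≈0#
  weight-reverseWalk c c′ antisym x (y ∷ ys) (x∉ys ∷ u) = begin
    weight c′ s (reverseWalk y ys ++ x ∷ [])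
      ≡⟨ weight-++ c′ s (reverseWalk y ys) (x ∷ []) ⟩
    weight c′ s (reverseWalk y ys) + weight c′ (lastV s (reverseWalk y ys)) (x ∷ [])
      ≡⟨ cong₂ _+_ (weight-reverseWalk c c′ antisym y ys u)
                   (cong (λ z → weight c′ z (x ∷ [])) (lastV-reverseWalk y ys)) ⟩
    - weight c y ys + (c′ y x + 0#)
      ≡⟨ cong (- weight c y ys +_) (trans (+-identityʳ _) (antisym x y (All.head x∉ys))) ⟩
    - weight c y ys + - c x y
      ≡⟨ -‿+-comm _ _ ⟩
    - (weight c y ys + c x y)
      ≡⟨ cong -_ (+-comm _ _) ⟩
    - (c x y + weight c y ys)
      ∎
    where s = lastV y ys

  NonPositiveCycles : (Fin n → Fin n → Set) → (Fin n → Fin n → Carrier) → Set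
  NonPositiveCycles R c =
    ∀ x qs → Unique (qs ++ x ∷ []) → Steps R x (qs ++ x ∷ []) → weight c x (qs ++ x ∷ []) ≤ 0#

  module _ {R c} (nonPositive : NonPositiveCycles R c) where
    open DecMembership (Fin._≟_ {n}) using (_∈?_)

    dropCycle : ∀ x zs → x ∈ zs → Unique zs → Steps R x zs →
                Σ (List (Fin n)) λ rs → IsPath x (lastV x zs) rs × Steps R x rs × (weight c x zs ≤ weight c x rs)
    dropCycle x zs x∈zs u s with ∈-∃++ x∈zs
    ... | qs , rs , refl =
      rs , (Unique-++⁻ʳ qs u , sym (lastV-++ x qs (x ∷ rs))) , proj₂ split , weight≤
      where
      split = Steps-split x qs s
      cycle-unique : Unique (qs ++ x ∷ [])
      cycle-unique = Unique-++⁻ˡ (qs ++ x ∷ []) (subst Unique (sym (List.++-assoc qs (x ∷ []) rs)) u)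
      weight≤ : weight c x (qs ++ x ∷ rs) ≤ weight c x rs
      weight≤ = subst₂ _≤_ (sym (weight-split c x qs)) (+-identityˡ _)
                  (+-monoˡ-≤ _ (nonPositive x qs cycle-unique (proj₁ split)))

    shortcut : ∀ x ws → Steps R x ws →
               Σ (List (Fin n)) λ ps → IsPath x (lastV x ws) ps × Steps R x ps × (weight c x ws ≤ weight c x ps)
    shortcut x []       _       = [] , ([] ∷ [] , refl) , tt , ≤-refl
    shortcut x (y ∷ ws) (r , s) with shortcut y ws s
    ... | ps , (u , last≡) , sp , ws≤ps with x ∈? (y ∷ ps)
    ...   | no  x∉ = (y ∷ ps) , (¬Any⇒All¬ _ x∉ ∷ u , last≡) , (r , sp) , +-monoʳ-≤ (c x y) ws≤ps
    ...   | yes x∈ =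
      let (rs , (u′ , last≡′) , sr , ps≤rs) = dropCycle x (y ∷ ps) x∈ u (r , sp)
      in rs , (u′ , trans last≡′ last≡) , sr , ≤-trans (+-monoʳ-≤ (c x y) ws≤ps) ps≤rs

module Separation (F : OrderedField) {n k : ℕ} (A : Matrix n) (d : Vec (OrderedField.Carrier F) k)
                  (d∈𝔻 : WithField.InD F d) (separates : WithField.Separates F A d) where
  open OrderedField F
  open OrderedFieldProperties F
  open DotProperties F
  open WithField F
  open Beta {n} {k} A
  open Walks F {n} {k} A

  Up Down : Fin n → Fin n → Set
  Up x y = x Fin.< y → 1 ℕ.≤ A x y
  Down = flip Up

  c⁺ c⁻ : Fin n → Fin n → Carrier
  c⁺ x y = dot d (β⁺ x y)
  c⁻ x y = dot d (β⁻ x y)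

  UpperPath LowerPath : Fin n → Fin n → List (Fin n) → Set
  UpperPath u v ws = IsPath u v ws × Steps Up u ws
  LowerPath u v ws = IsPath u v ws × Steps Down u ws

  UBSteps≡Steps : ∀ x ws → UBSteps x ws ≡ Steps Up x ws
  UBSteps≡Steps x []       = refl
  UBSteps≡Steps x (y ∷ ws) = cong (Up x y ×_) (UBSteps≡Steps y ws)

  LBSteps≡Steps : ∀ x ws → LBSteps x ws ≡ Steps Down x ws
  LBSteps≡Steps x []       = refl
  LBSteps≡Steps x (y ∷ ws) = cong (Down x y ×_) (LBSteps≡Steps y ws)

  dot-β⁺W : ∀ x ws → dot d (β⁺W x ws) ≡ weight c⁺ x ws
  dot-β⁺W x []       = dot-zeroV d
  dot-β⁺W x (y ∷ ws) = trans (dot-⊕ d (β⁺ x y) (β⁺W y ws)) (cong (c⁺ x y +_) (dot-β⁺W y ws))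

  dot-β⁻W : ∀ x ws → dot d (β⁻W x ws) ≡ weight c⁻ x ws
  dot-β⁻W x []       = dot-zeroV d
  dot-β⁻W x (y ∷ ws) = trans (dot-⊕ d (β⁻ x y) (β⁻W y ws)) (cong (c⁻ x y +_) (dot-β⁻W y ws))

  UB-upperPath : ∀ {u v ws} → UpperPath u v ws → UB u v (β⁺W u ws)
  UB-upperPath {u} {ws = ws} (path , s) = ws , path , subst id (sym (UBSteps≡Steps u ws)) s , refl

  LB-lowerPath : ∀ {u v ws} → LowerPath u v ws → LB u v (β⁻W u ws)
  LB-lowerPath {u} {ws = ws} (path , s) = ws , path , subst id (sym (LBSteps≡Steps u ws)) s , refl

  UB⇒upperPath : ∀ {u v b} → UB u v b →
                 Σ (List (Fin n)) λ ws → UpperPath u v ws × dot d b ≡ weight c⁺ u ws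
  UB⇒upperPath {u} (ws , path , s , refl) = ws , (path , subst id (UBSteps≡Steps u ws) s) , dot-β⁺W u ws

  LB⇒lowerPath : ∀ {u v a} → LB u v a →
                 Σ (List (Fin n)) λ ws → LowerPath u v ws × dot d a ≡ weight c⁻ u ws
  LB⇒lowerPath {u} (ws , path , s , refl) = ws , (path , subst id (LBSteps≡Steps u ws) s) , dot-β⁻W u ws

  lowerPath<upperPath : ∀ {u v ps qs} → u Fin.< v → LowerPath u v ps → UpperPath u v qs →
                        weight c⁻ u ps < weight c⁺ u qs
  lowerPath<upperPath {u} {v} {ps} {qs} u<v lower upper =
    subst₂ _<_ (dot-β⁻W u ps) (dot-β⁺W u qs)
      (separates u v u<v _ _ (UB-upperPath upper) (LB-lowerPath lower))

  c⁺-flip : ∀ x y → x ≢ y → c⁺ y x ≡ - c⁻ x y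
  c⁺-flip x y x≢y with y Fin.<? x | x Fin.<? y
  ... | yes y<x | yes x<y = ⊥-elim (Fin.<-asym y<x x<y)
  ... | yes _   | no  _   = sym (trans (cong -_ (dot-negV d _)) (-‿involutive _))
  ... | no  _   | yes _   = dot-negV d _
  ... | no  y≮x | no  x≮y with Fin.<-cmp x y
  ...   | tri< x<y _ _ = ⊥-elim (x≮y x<y)
  ...   | tri≈ _ x≡y _ = ⊥-elim (x≢y x≡y)
  ...   | tri> _ _ y<x = ⊥-elim (y≮x y<x)

  c⁻-flip : ∀ x y → x ≢ y → c⁻ y x ≡ - c⁺ x y
  c⁻-flip x y x≢y = trans (sym (-‿involutive _)) (cong -_ (sym (c⁺-flip y x (x≢y ∘ sym))))

  reverse-upperPath : ∀ {u v ws} → UpperPath u v ws →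
                      LowerPath v u (reverseWalk u ws) × weight c⁻ v (reverseWalk u ws) ≡ - weight c⁺ u ws
  reverse-upperPath {u} {ws = ws} (path@(unique , refl) , s) =
    (IsPath-reverseWalk ws path , Steps-reverseWalk u ws s) , weight-reverseWalk c⁺ c⁻ c⁻-flip u ws unique

  reverse-lowerPath : ∀ {u v ws} → LowerPath u v ws →
                      UpperPath v u (reverseWalk u ws) × weight c⁺ v (reverseWalk u ws) ≡ - weight c⁻ u ws
  reverse-lowerPath {u} {ws = ws} (path@(unique , refl) , s) =
    (IsPath-reverseWalk ws path , Steps-reverseWalk u ws s) , weight-reverseWalk c⁻ c⁺ c⁺-flip u ws unique

  c⁻-loop : ∀ x → c⁻ x x ≤ 0#
  c⁻-loop x with x Fin.<? x
  ... | yes x<x = ⊥-elim (Fin.<-irrefl refl x<x)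
  ... | no  _   = subst (_≤ 0#) (sym (trans (dot-negV d _) (cong -_ (dot-χ d (A x x)))))
                    (neg-nonpos (dAt-nonneg d∈𝔻 (A x x)))

  -- A cycle x → y ⇝ x: separation compares the step x → y with the reversed rest if x < y,
  -- and the rest with the reversed step y → x if y < x.
  lowerCycles-nonPositive : NonPositiveCycles Down c⁻
  lowerCycles-nonPositive x []       _               _         =
    subst (_≤ 0#) (sym (+-identityʳ (c⁻ x x))) (c⁻-loop x)
  lowerCycles-nonPositive x (y ∷ zs) u@(y∉zs∷x ∷ _) (x↓y , s) =
    <⇒≤ (cycle< (Fin.<-cmp x y))
    where
    y≢x : y ≢ x
    y≢x = All.head (++⁻ʳ zs y∉zs∷x)
    back : LowerPath y x (zs ++ x ∷ [])
    back = (u , lastV-++ y zs (x ∷ [])) , s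
    W = weight c⁻ y (zs ++ x ∷ [])
    cycle< : Tri (x Fin.< y) (x ≡ y) (y Fin.< x) → c⁻ x y + W < 0#
    cycle< (tri< x<y _ _) =
      let (forth , weight≡) = reverse-lowerPath back
      in x<-y⇒x+y<0 (subst₂ _<_ (+-identityʳ _) weight≡
           (lowerPath<upperPath x<y (edgePath (y≢x ∘ sym) , x↓y , tt) forth))
    cycle< (tri≈ _ x≡y _) = ⊥-elim (y≢x (sym x≡y))
    cycle< (tri> _ _ y<x) =
      subst (_< 0#) (+-comm W _) (x<-y⇒x+y<0 (subst (W <_) (trans (+-identityʳ _) (c⁺-flip x y (y≢x ∘ sym)))
        (lowerPath<upperPath y<x back (edgePath y≢x , x↓y , tt))))

  join-lower-upper : ∀ {i j v ps qs} → LowerPath i v ps → UpperPath j v qs →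
                     Σ (List (Fin n)) λ cs → LowerPath i j cs × ((weight c⁻ i ps - weight c⁺ j qs) ≤ weight c⁻ i cs)
  join-lower-upper {i} {j} {ps = ps} {qs} ((uniqueₚ , lastₚ) , sₚ) upper =
    let (cs , (uniqueₛ , lastₛ) , sₛ , walk≤cs) = shortcut lowerCycles-nonPositive i (ps ++ R) walk-steps
    in cs , ((uniqueₛ , trans lastₛ walk-last) , sₛ) , subst (_≤ weight c⁻ i cs) walk-weight walk≤cs
    where
    R = reverseWalk j qs
    back = reverse-upperPath upper
    walk-steps : Steps Down i (ps ++ R)
    walk-steps = Steps-++ i ps sₚ (subst (λ z → Steps Down z R) (sym lastₚ) (proj₂ (proj₁ back)))
    walk-last : lastV i (ps ++ R) ≡ j
    walk-last = trans (lastV-++ i ps R) (trans (cong (λ z → lastV z R) lastₚ) (proj₂ (proj₁ (proj₁ back))))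
    walk-weight : weight c⁻ i (ps ++ R) ≡ weight c⁻ i ps - weight c⁺ j qs
    walk-weight = trans (weight-++ c⁻ i ps R)
                    (cong (weight c⁻ i ps +_) (trans (cong (λ z → weight c⁻ z R) lastₚ) (proj₂ back)))

  c⁻-edge : ∀ {u v} → u Fin.< v → c⁻ u v ≡ dAt d (suc (A u v))
  c⁻-edge {u} {v} u<v with u Fin.<? v
  ... | no u≮v = ⊥-elim (u≮v u<v)
  ... | yes _ with A u v ℕ.≟ k
  ...   | yes A≡k = trans (dot-zeroV d) (sym (dAt-≮ d (A u v) (ℕ.<-irrefl A≡k)))
  ...   | no  _   = dot-χ d (suc (A u v))

  c⁺-edge : ∀ {u v} → u Fin.< v → c⁺ u v ≡ dAt d (A u v)
  c⁺-edge {u} {v} u<v with u Fin.<? v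
  ... | no u≮v = ⊥-elim (u≮v u<v)
  ... | yes _  = dot-χ d (A u v)

  module Potential (Π : Fin n → Carrier) (isPi : IsPi A d Π) where

    Bracketed : Fin n → Fin n → Set
    Bracketed u v = (∀ ws → UpperPath u v ws → Π v - Π u < weight c⁺ u ws)
                  × (∀ ws → LowerPath u v ws → weight c⁻ u ws < Π v - Π u)

    BracketedBelow : Fin n → Set
    BracketedBelow v = ∀ w → w Fin.< v → ∀ u → u Fin.< w → Bracketed u w

    lowerPath-bound : ∀ {v i j cs} → BracketedBelow v → i Fin.< v → j Fin.< v → i ≢ j →
                      LowerPath i j cs → weight c⁻ i cs < Π j - Π i
    lowerPath-bound {i = i} {j} below i<v j<v i≢j lower with Fin.<-cmp i j
    ... | tri< i<j _ _ = proj₂ (below j j<v i i<j) _ lower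
    ... | tri≈ _ i≡j _ = ⊥-elim (i≢j i≡j)
    ... | tri> _ _ j<i =
      let (upper , weight≡) = reverse-lowerPath lower
      in x-y<-z⇒z<y-x (subst (_ <_) weight≡ (proj₁ (below i i<v j j<i) _ upper))

    lowerValue<upperValue : ∀ {v i j ps qs} → BracketedBelow v → i Fin.< v → j Fin.< v →
                            LowerPath i v ps → UpperPath j v qs →
                            Π i + weight c⁻ i ps < Π j + weight c⁺ j qs
    lowerValue<upperValue {i = i} {j} below i<v j<v lower upper with i Fin.≟ j
    ... | yes refl = +-monoʳ-< (Π i) (lowerPath<upperPath i<v lower upper)
    ... | no  i≢j  =
      let (cs , lower′ , walk≤cs) = join-lower-upper lower upper
      in x-y<z-w⇒w+x<z+y (≤-<-trans walk≤cs (lowerPath-bound below i<v j<v i≢j lower′))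

    LBvals<UBvals : ∀ {v x y} → BracketedBelow v → LBvals A d Π v x → UBvals A d Π v y → x < y
    LBvals<UBvals below (i , i<v , a , a∈LB , refl) (j , j<v , b , b∈UB , refl) =
      let (ps , lower , a≡) = LB⇒lowerPath a∈LB
          (qs , upper , b≡) = UB⇒upperPath b∈UB
      in subst₂ _<_ (cong (Π i +_) (sym a≡)) (cong (Π j +_) (sym b≡))
           (lowerValue<upperValue below i<v j<v lower upper)

    bracketed-step : ∀ v → BracketedBelow v → ∀ u → u Fin.< v → Bracketed u v
    bracketed-step v below u u<v with proj₂ isPi v (ℕ.≤-<-trans ℕ.z≤n u<v)
    ... | ub , lb , (ub∈ , ub-min) , (lb∈ , lb-max) , 2Πv≡ub+lb = upper-bound , lower-bound
      where
      lb<Πv<ub = midpoint (LBvals<UBvals below lb∈ ub∈) 2Πv≡ub+lb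
      upper-bound : ∀ ws → UpperPath u v ws → Π v - Π u < weight c⁺ u ws
      upper-bound ws upper = x<y+z⇒x-y<z (<-≤-trans (proj₂ lb<Πv<ub)
        (subst (ub ≤_) (cong (Π u +_) (dot-β⁺W u ws)) (ub-min _ (u , u<v , _ , UB-upperPath upper , refl))))
      lower-bound : ∀ ws → LowerPath u v ws → weight c⁻ u ws < Π v - Π u
      lower-bound ws lower = y+z<x⇒z<x-y (≤-<-trans
        (subst (_≤ lb) (cong (Π u +_) (dot-β⁻W u ws)) (lb-max _ (u , u<v , _ , LB-lowerPath lower , refl)))
        (proj₁ lb<Πv<ub))

    bracketed : ∀ v → Acc Fin._<_ v → ∀ u → u Fin.< v → Bracketed u v
    bracketed v (acc rec) = bracketed-step v (λ w w<v → bracketed w (rec w<v))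

    edge-lower : ∀ {u v} → u Fin.< v → dAt d (suc (A u v)) < Π v - Π u
    edge-lower {u} {v} u<v =
      subst (_< _) (trans (+-identityʳ _) (c⁻-edge u<v))
        (proj₂ (bracketed v (<-wellFounded v) u u<v) (v ∷ [])
          (edgePath (Fin.<⇒≢ u<v) , (λ v<u → ⊥-elim (Fin.<-asym u<v v<u)) , tt))

    edge-upper : ∀ {u v t} → u Fin.< v → A u v ≡ suc t → Π v - Π u < dAt d (suc t)
    edge-upper {u} {v} u<v A≡t+1 =
      subst (_ <_) (trans (+-identityʳ _) (trans (c⁺-edge u<v) (cong (dAt d) A≡t+1)))
        (proj₁ (bracketed v (<-wellFounded v) u u<v) (v ∷ [])
          (edgePath (Fin.<⇒≢ u<v) , (λ _ → subst (1 ℕ.≤_) (sym A≡t+1) (s≤s ℕ.z≤n)) , tt))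

    edge-Between : ∀ {u v} → u Fin.< v → Between d (A u v) (Π v - Π u)
    edge-Between {u} {v} u<v = between (A u v) refl
      where
      between : ∀ t → A u v ≡ t → Between d t (Π v - Π u)
      between zero    A≡0   = subst (λ t → dAt d (suc t) < _) A≡0 (edge-lower u<v) , tt
      between (suc t) A≡t+1 = subst (λ t → dAt d (suc t) < _) A≡t+1 (edge-lower u<v) , edge-upper u<v A≡t+1

lemma5 : (F : OrderedField) (n k : ℕ) (A : Matrix n) (d : Vec (OrderedField.Carrier F) k)
    → IsRobinson A → EntriesIn0to k A → DiagonalIs k A
    → WithField.InD F d
    → WithField.Separates F A d
    → (Π : Fin n → OrderedField.Carrier F)
    → WithField.IsPi F A d Π
    → ∀ (u v : Fin n) → u Fin.< v → ∀ (t : ℕ) → t ℕ.≤ k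
    → (A u v ≡ t) ⇔ WithField.Between F d t (OrderedField._-_ F (Π v) (Π u))
lemma5 F n k A d _ _ _ d∈𝔻 separates Π isPi u v u<v t _ =
  mk⇔ (λ A≡t → subst (λ s → Between d s (Π v - Π u)) A≡t (edge-Between u<v))
      (DotProperties.Between-unique F d∈𝔻 (edge-Between u<v))
  where
  open OrderedField F using (_-_)
  open WithField F using (Between)
  open Separation.Potential F A d d∈𝔻 separates Π isPi using (edge-Between)
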